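{- For every pair of integers $k \ge 2$ and $n \ge 3$, we have $\chi'_{st}(C_{2k} \,\square\, P_n) = 6$.
   Context: A star edge-coloring of a graph $G$ is a proper edge-coloring of $G$ in which there is no bichromatic path and no bichromatic cycle of length four (i.e., with four edges). The star chromatic index $\chi'_{st}(G)$ is the minimum number of colors in a star edge-coloring of $G$. $C_m$ denotes the cycle on $m$ vertices and $P_n$ the path on $n$ vertices. $G \,\square\, H$ denotes the Cartesian product: vertex set $V(G)\times V(H)$, with $(u,v)(u',v')$ an edge iff either $uu'\in E(G)$ and $v=v'$, or $u=u'$ and $vv'\in E(H)$. -}

module Defs where

open import Data.Nat using (ℕ; suc; _<_)
open import Data.Fin using (Fin; toℕ)
open import Data.Product using (Σ; _×_)
open import Data.Sum using (_⊎_)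
open import Relation.Binary.PropositionalEquality using (_≡_; _≢_)
open import Relation.Nullary using (¬_)

record Graph : Set₁ where
  field
    V   : Set
    Adj : V → V → Set
open Graph public

CycSucc : (m : ℕ) → Fin m → Fin m → Set
CycSucc m i j = (toℕ j ≡ suc (toℕ i)) ⊎ ((suc (toℕ i) ≡ m) × (toℕ j ≡ 0))

Cycle : ℕ → Graph
Cycle m = record
  { V   = Fin m
  ; Adj = λ i j → CycSucc m i j ⊎ CycSucc m j i }

Path : ℕ → Graph
Path n = record
  { V   = Fin n
  ; Adj = λ i j → (toℕ j ≡ suc (toℕ i)) ⊎ (toℕ i ≡ suc (toℕ j)) }

_□_ : Graph → Graph → Graph
G □ H = record
  { V   = V G × V H
  ; Adj = λ p q →
      (Adj G (Data.Product.proj₁ p) (Data.Product.proj₁ q) × Data.Product.proj₂ p ≡ Data.Product.proj₂ q)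
      ⊎ (Data.Product.proj₁ p ≡ Data.Product.proj₁ q × Adj H (Data.Product.proj₂ p) (Data.Product.proj₂ q)) }

-- An edge-colouring with m colours: a colour for each ordered pair of
-- vertices, required to be symmetric on edges (values on non-edges are irrelevant).
record EdgeColouring (G : Graph) (m : ℕ) : Set where
  field
    col   : V G → V G → Fin m
    symm  : ∀ u v → Adj G u v → col u v ≡ col v u
open EdgeColouring public

Proper : (G : Graph) {m : ℕ} → EdgeColouring G m → Set
Proper G c = ∀ u v w → Adj G u v → Adj G u w → v ≢ w → col c u v ≢ col c u w

-- A bichromatic path or cycle of length four (four edges):
-- a trail v0 v1 v2 v3 v4 with v0,v1,v2,v3 pairwise distinct, v4 distinct from
-- v1,v2,v3 (v4 = v0 gives a 4-cycle, otherwise a path on 5 vertices), whose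
-- edge colours alternate: col(v0v1) = col(v2v3) and col(v1v2) = col(v3v4).
BichromaticP4orC4 : (G : Graph) {m : ℕ} → EdgeColouring G m → Set
BichromaticP4orC4 G c =
  Σ (V G) λ v0 → Σ (V G) λ v1 → Σ (V G) λ v2 → Σ (V G) λ v3 → Σ (V G) λ v4 →
    (Adj G v0 v1 × Adj G v1 v2 × Adj G v2 v3 × Adj G v3 v4)
  × (v0 ≢ v1 × v0 ≢ v2 × v0 ≢ v3 × v1 ≢ v2 × v1 ≢ v3 × v2 ≢ v3)
  × (v4 ≢ v1 × v4 ≢ v2 × v4 ≢ v3)
  × (col c v0 v1 ≡ col c v2 v3 × col c v1 v2 ≡ col c v3 v4)

record StarEdgeColouring (G : Graph) (m : ℕ) : Set where
  field
    colouring : EdgeColouring G m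
    proper    : Proper G colouring
    noBichrom : ¬ BichromaticP4orC4 G colouring

StarChromaticIndex : Graph → ℕ → Set
StarChromaticIndex G m =
  StarEdgeColouring G m × (∀ j → j < m → ¬ StarEdgeColouring G j)

-- Six colours suffice: the columns of C_N □ P_n are labelled by a closed walk in a small
-- digraph of "column types" (0 → 1 → 2 → 3 → 0, with the detour 3 → 4 → 5 → 0 taken once
-- when N ≡ 2 mod 4) and the rows by their index mod 4; the colour of an edge is read off a
-- table from the labels of its ends.  A step of the grid (right, left, up or down) projects to
-- a step between labels, so a bichromatic trail would project to a bichromatic non-backtracking
-- labelled walk of length four, and a finite check shows there is none.
--
-- Five colours do not suffice: C_N □ P_n contains P_5 □ P_3 when N ≥ 5 and C_4 □ P_3 when
-- N = 4, and neither has a star edge-colouring with five colours.  This is checked by a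
-- backtracking search, after permuting colours so that the four edges at a vertex of degree
-- four get the colours 0, 1, 2, 3.

module Submission where

open import Data.Bool using (Bool; true; T; not; _∧_; if_then_else_)
open import Data.Empty using (⊥; ⊥-elim)
open import Data.Fin using (Fin; toℕ; inject≤)
open import Data.Fin.Patterns
open import Data.Fin.Properties using (all?; toℕ-injective; toℕ<n; toℕ-inject≤; inject≤-injective)
  renaming (_≟_ to _≟ᶠ_)
open import Data.List using (List; []; _∷_; _++_; map; concatMap; mapMaybe; filter; allFin; drop; cartesianProduct)
open import Data.List.Membership.Propositional using (_∈_)
open import Data.List.Membership.Propositional.Properties using (∈-allFin; ∈-map⁺; ∈-filter⁺)
open import Data.List.Membership.DecPropositional (_≟ᶠ_ {6}) using (_∈?_)
open import Data.List.Relation.Unary.All as All using (All; []; _∷_)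
open import Data.List.Relation.Unary.Any as Any using (Any; here; there)
open import Data.Maybe as Maybe using (Maybe; just; nothing)
open import Data.Maybe.Relation.Unary.All using (just; nothing) renaming (All to MaybeAll)
open import Data.Nat as ℕ using (ℕ; zero; suc; _+_; _≤_; _≥_; _*_; _⊔_; z≤n; s≤s)
open import Data.Nat.Properties
  using (suc-injective; <-irrefl; 1+n≢n; 0≢1+n; ≤-pred; <⇒≤; *-monoʳ-≤; m≤m+n; *-distribˡ-+)
open import Data.Product using (Σ; _×_; _,_; proj₁; proj₂; swap)
open import Data.Product.Properties using (,-injective)
open import Data.Sum using (_⊎_; inj₁; inj₂)
open import Function using (_∘_)
open import Function.Definitions using (Injective)
open import Relation.Binary.Definitions using (DecidableEquality)
open import Relation.Binary.PropositionalEquality using (_≡_; _≢_; refl; sym; trans; cong; cong₂; subst)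
open import Relation.Nullary using (¬_; Dec; yes; no; does)
open import Relation.Nullary.Decidable
  using (True; toWitness; map′; _×-dec_; _⊎-dec_; _→-dec_; ¬?; T?; dec-true; dec-false)
open import Relation.Nullary.Decidable.Core using (dec⇒maybe)

open import Defs

private
  variable
    G G′ H H′ : Graph
    m n p q : ℕ

Distinctness : {A : Set} → A → A → A → A → A → Set
Distinctness v₀ v₁ v₂ v₃ v₄ =
  (v₀ ≢ v₁ × v₀ ≢ v₂ × v₀ ≢ v₃ × v₁ ≢ v₂ × v₁ ≢ v₃ × v₂ ≢ v₃) × (v₄ ≢ v₁ × v₄ ≢ v₂ × v₄ ≢ v₃)

Trail : (G : Graph) → V G → V G → V G → V G → V G → Set
Trail G v₀ v₁ v₂ v₃ v₄ = (Adj G v₀ v₁ × Adj G v₁ v₂ × Adj G v₂ v₃ × Adj G v₃ v₄) × Distinctness v₀ v₁ v₂ v₃ v₄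

Alternating : EdgeColouring G q → V G → V G → V G → V G → V G → Set
Alternating c v₀ v₁ v₂ v₃ v₄ = col c v₀ v₁ ≡ col c v₂ v₃ × col c v₁ v₂ ≡ col c v₃ v₄

noAlternatingTrail : (s : StarEdgeColouring G q) → ∀ {v₀ v₁ v₂ v₃ v₄} →
  Trail G v₀ v₁ v₂ v₃ v₄ → ¬ Alternating (StarEdgeColouring.colouring s) v₀ v₁ v₂ v₃ v₄
noAlternatingTrail s (as , ds , ds′) alt = StarEdgeColouring.noBichrom s (_ , _ , _ , _ , _ , as , ds , ds′ , alt)

record _↪_ (H G : Graph) : Set where
  field
    embed     : V H → V G
    injective : Injective _≡_ _≡_ embed
    preserves : ∀ {u v} → Adj H u v → Adj G (embed u) (embed v)

restrict : H ↪ G → StarEdgeColouring G q → StarEdgeColouring H q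
restrict e s = record
  { colouring = record { col = λ u v → col c (embed u) (embed v) ; symm = λ u v uv → symm c _ _ (preserves uv) }
  ; proper    = λ u v w uv uw v≢w → proper s _ _ _ (preserves uv) (preserves uw) (v≢w ∘ injective)
  ; noBichrom = λ (_ , _ , _ , _ , _ , (a₀₁ , a₁₂ , a₂₃ , a₃₄) , (d₀₁ , d₀₂ , d₀₃ , d₁₂ , d₁₃ , d₂₃) , (d₄₁ , d₄₂ , d₄₃) , alt) →
      noAlternatingTrail s
        ( (preserves a₀₁ , preserves a₁₂ , preserves a₂₃ , preserves a₃₄)
        , (d₀₁ ∘ injective , d₀₂ ∘ injective , d₀₃ ∘ injective , d₁₂ ∘ injective , d₁₃ ∘ injective , d₂₃ ∘ injective)
        , (d₄₁ ∘ injective , d₄₂ ∘ injective , d₄₃ ∘ injective))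
        alt
  }
  where
  open _↪_ e
  open StarEdgeColouring
  c = colouring s

recolour : (π : Fin p → Fin q) → Injective _≡_ _≡_ π → StarEdgeColouring G p → StarEdgeColouring G q
recolour π π-injective s = record
  { colouring = record { col = λ u v → π (col c u v) ; symm = λ u v uv → cong π (symm c u v uv) }
  ; proper    = λ u v w uv uw v≢w → proper s u v w uv uw v≢w ∘ π-injective
  ; noBichrom = λ (v₀ , v₁ , v₂ , v₃ , v₄ , as , ds , ds′ , (e₁ , e₂)) →
      noBichrom s (v₀ , v₁ , v₂ , v₃ , v₄ , as , ds , ds′ , π-injective e₁ , π-injective e₂)
  }
  where
  open StarEdgeColouring
  c = colouring s

↪-refl : G ↪ G
↪-refl = record { embed = λ v → v ; injective = λ e → e ; preserves = λ a → a }

_□↪_ : G ↪ G′ → H ↪ H′ → (G □ H) ↪ (G′ □ H′)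
f □↪ g = record
  { embed     = λ (a , b) → F.embed a , G.embed b
  ; injective = λ e → cong₂ _,_ (F.injective (cong proj₁ e)) (G.injective (cong proj₂ e))
  ; preserves = λ { (inj₁ (a , e)) → inj₁ (F.preserves a , cong G.embed e)
                  ; (inj₂ (e , b)) → inj₂ (cong F.embed e , G.preserves b) }
  }
  where
  module F = _↪_ f
  module G = _↪_ g

inject≤-suc : (m≤n : m ≤ n) {i j : Fin m} → toℕ j ≡ suc (toℕ i) →
  toℕ (inject≤ j m≤n) ≡ suc (toℕ (inject≤ i m≤n))
inject≤-suc m≤n {i} {j} e = trans (toℕ-inject≤ j m≤n) (trans e (cong suc (sym (toℕ-inject≤ i m≤n))))

path↪path : m ≤ n → Path m ↪ Path n
path↪path m≤n = record
  { embed     = λ i → inject≤ i m≤n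
  ; injective = inject≤-injective m≤n m≤n _ _
  ; preserves = λ { (inj₁ e) → inj₁ (inject≤-suc m≤n e) ; (inj₂ e) → inj₂ (inject≤-suc m≤n e) }
  }

path↪cycle : m ≤ n → Path m ↪ Cycle n
path↪cycle m≤n = record
  { embed     = λ i → inject≤ i m≤n
  ; injective = inject≤-injective m≤n m≤n _ _
  ; preserves = λ { (inj₁ e) → inj₁ (inj₁ (inject≤-suc m≤n e)) ; (inj₂ e) → inj₂ (inj₁ (inject≤-suc m≤n e)) }
  }

record DecidableGraph (G : Graph) : Set where
  field
    _≟_      : DecidableEquality (V G)
    adj?     : ∀ u v → Dec (Adj G u v)
    -- Need not contain every vertex: it only seeds the generation of constraints for the search.
    vertices : List (V G)

  neighbours : V G → List (V G)
  neighbours u = filter (adj? u) vertices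

cycSucc? : ∀ m (i j : Fin m) → Dec (CycSucc m i j)
cycSucc? m i j = (toℕ j ℕ.≟ suc (toℕ i)) ⊎-dec ((suc (toℕ i) ℕ.≟ m) ×-dec (toℕ j ℕ.≟ 0))

cycleᵈ : ∀ m → DecidableGraph (Cycle m)
cycleᵈ m = record { _≟_ = _≟ᶠ_ ; adj? = λ i j → cycSucc? m i j ⊎-dec cycSucc? m j i ; vertices = allFin m }

pathᵈ : ∀ n → DecidableGraph (Path n)
pathᵈ n = record
  { _≟_ = _≟ᶠ_ ; adj? = λ i j → (toℕ j ℕ.≟ suc (toℕ i)) ⊎-dec (toℕ i ℕ.≟ suc (toℕ j)) ; vertices = allFin n }

pair? : {A B : Set} → DecidableEquality A → DecidableEquality B → DecidableEquality (A × B)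
pair? _≟ᴬ_ _≟ᴮ_ (a , b) (a′ , b′) = map′ (λ (e , e′) → cong₂ _,_ e e′) ,-injective (a ≟ᴬ a′ ×-dec b ≟ᴮ b′)

_□ᵈ_ : DecidableGraph G → DecidableGraph H → DecidableGraph (G □ H)
Gᵈ □ᵈ Hᵈ = record
  { _≟_      = pair? G._≟_ H._≟_
  ; adj?     = λ (a , b) (a′ , b′) → (G.adj? a a′ ×-dec H._≟_ b b′) ⊎-dec (G._≟_ a a′ ×-dec H.adj? b b′)
  ; vertices = cartesianProduct G.vertices H.vertices
  }
  where
  module G = DecidableGraph Gᵈ
  module H = DecidableGraph Hᵈ

-- Refuting star edge-colourings by backtracking search

elim-if-does : {A B : Set} (d : Dec A) (R : B → Set) {x y : B} → (A → R x) → R y → R (if does d then x else y)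
elim-if-does (yes a) R f _ = f a
elim-if-does (no _)  R _ r = r

differᵇ : Maybe (Fin q) → Maybe (Fin q) → Bool
differᵇ (just a) (just b) = not (does (a ≟ᶠ b))
differᵇ _        _        = true

differᵇ-sound : ∀ {x y : Fin q} {m n} → MaybeAll (x ≡_) m → MaybeAll (y ≡_) n → x ≢ y → T (differᵇ m n)
differᵇ-sound (just refl) (just refl) x≢y rewrite dec-false (_ ≟ᶠ _) x≢y = _
differᵇ-sound (just _)    nothing     _   = _
differᵇ-sound nothing     _           _   = _

nonAlternatingᵇ : Maybe (Fin q) → Maybe (Fin q) → Maybe (Fin q) → Maybe (Fin q) → Bool
nonAlternatingᵇ (just a) (just b) (just c) (just d) = not (does (a ≟ᶠ c) ∧ does (b ≟ᶠ d))
nonAlternatingᵇ _        _        _        _        = true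

nonAlternatingᵇ-sound : ∀ {w x y z : Fin q} {m₀ m₁ m₂ m₃} →
  MaybeAll (w ≡_) m₀ → MaybeAll (x ≡_) m₁ → MaybeAll (y ≡_) m₂ → MaybeAll (z ≡_) m₃ →
  ¬ (w ≡ y × x ≡ z) → T (nonAlternatingᵇ m₀ m₁ m₂ m₃)
nonAlternatingᵇ-sound {w = w} {x} {y} {z} (just refl) (just refl) (just refl) (just refl) ¬alt
  with w ≟ᶠ y | x ≟ᶠ z
... | yes w≡y | yes x≡z = ¬alt (w≡y , x≡z)
... | yes _   | no _    = _
... | no _    | _       = _
nonAlternatingᵇ-sound (just _) (just _) (just _) nothing _ = _
nonAlternatingᵇ-sound (just _) (just _) nothing  _       _ = _
nonAlternatingᵇ-sound (just _) nothing  _        _       _ = _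
nonAlternatingᵇ-sound nothing  _        _        _       _ = _

module Refutation {G : Graph} (Gᵈ : DecidableGraph G) (q : ℕ) where
  open DecidableGraph Gᵈ

  data Constraint : Set where
    fan   : (u v w : V G) → Constraint
    trail : (v₀ v₁ v₂ v₃ v₄ : V G) → Constraint

  Valid : Constraint → Set
  Valid (fan u v w)             = Adj G u v × Adj G u w × v ≢ w
  Valid (trail v₀ v₁ v₂ v₃ v₄) = Trail G v₀ v₁ v₂ v₃ v₄

  valid? : ∀ k → Dec (Valid k)
  valid? (fan u v w)             = adj? u v ×-dec adj? u w ×-dec ¬? (v ≟ w)
  valid? (trail v₀ v₁ v₂ v₃ v₄) =
    (adj? v₀ v₁ ×-dec adj? v₁ v₂ ×-dec adj? v₂ v₃ ×-dec adj? v₃ v₄) ×-dec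
    ((¬? (v₀ ≟ v₁) ×-dec ¬? (v₀ ≟ v₂) ×-dec ¬? (v₀ ≟ v₃) ×-dec ¬? (v₁ ≟ v₂) ×-dec ¬? (v₁ ≟ v₃) ×-dec ¬? (v₂ ≟ v₃))
      ×-dec (¬? (v₄ ≟ v₁) ×-dec ¬? (v₄ ≟ v₂) ×-dec ¬? (v₄ ≟ v₃)))

  Respects : EdgeColouring G q → Constraint → Set
  Respects c (fan u v w)             = col c u v ≢ col c u w
  Respects c (trail v₀ v₁ v₂ v₃ v₄) = ¬ Alternating c v₀ v₁ v₂ v₃ v₄

  respects : (s : StarEdgeColouring G q) → ∀ {k} → Valid k → Respects (StarEdgeColouring.colouring s) k
  respects s {fan u v w}        (uv , uw , v≢w) = StarEdgeColouring.proper s u v w uv uw v≢w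
  respects s {trail _ _ _ _ _} t               = noAlternatingTrail s t

  Certified : Set
  Certified = Σ Constraint Valid

  -- Candidates come from the neighbour lists and are kept only when their validity is decided,
  -- so nothing needs to be proved about how they were generated.
  certified : List Certified
  certified = mapMaybe (λ k → Maybe.map (k ,_) (dec⇒maybe (valid? k))) (concatMap around vertices)
    where
    around : V G → List Constraint
    around v₀ =
      concatMap (λ v₁ → map (fan v₀ v₁) (neighbours v₀)) (neighbours v₀) ++
      concatMap (λ v₁ → concatMap (λ v₂ → concatMap (λ v₃ → map (trail v₀ v₁ v₂ v₃)
        (neighbours v₃)) (neighbours v₂)) (neighbours v₁)) (neighbours v₀)

  Partial : Set
  Partial = List ((V G × V G) × Fin q)

  Agrees : EdgeColouring G q → Partial → Set
  Agrees c = All (λ ((x , y) , a) → col c x y ≡ a)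

  sameEdge? : (e e′ : V G × V G) → Dec (e ≡ e′ ⊎ swap e ≡ e′)
  sameEdge? e e′ = pair? _≟_ _≟_ e e′ ⊎-dec pair? _≟_ _≟_ (swap e) e′

  find : Partial → V G → V G → Maybe (Fin q)
  find []                    u v = nothing
  find (((x , y) , a) ∷ π) u v = if does (sameEdge? (x , y) (u , v)) then just a else find π u v

  find-sound : ∀ c {π} → Agrees c π → ∀ {u v} → Adj G u v → MaybeAll (col c u v ≡_) (find π u v)
  find-sound c []                                uv = nothing
  find-sound c {((x , y) , a) ∷ π} (h ∷ hs) {u} {v} uv =
    elim-if-does (sameEdge? (x , y) (u , v)) (MaybeAll (col c u v ≡_))
      (λ { (inj₁ refl) → just h ; (inj₂ refl) → just (trans (symm c u v uv) h) })
      (find-sound c hs uv)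

  consistent : Partial → Constraint → Bool
  consistent π (fan u v w)             = differᵇ (find π u v) (find π u w)
  consistent π (trail v₀ v₁ v₂ v₃ v₄) = nonAlternatingᵇ (find π v₀ v₁) (find π v₁ v₂) (find π v₂ v₃) (find π v₃ v₄)

  consistent-sound : ∀ c {π} → Agrees c π → ∀ {k} → Valid k → Respects c k → T (consistent π k)
  consistent-sound c agr {fan _ _ _} (uv , uw , _) =
    differᵇ-sound (find-sound c agr uv) (find-sound c agr uw)
  consistent-sound c agr {trail _ _ _ _ _} ((a₀₁ , a₁₂ , a₂₃ , a₃₄) , _) =
    nonAlternatingᵇ-sound (find-sound c agr a₀₁) (find-sound c agr a₁₂) (find-sound c agr a₂₃) (find-sound c agr a₃₄)

  -- A plan lists the edges to colour in turn, each with the constraints to check once it is coloured.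
  Plan : Set
  Plan = List ((V G × V G) × List Certified)

  Refutes : Plan → Partial → Set
  Refutes []                π = ⊥
  Refutes ((e , ks) ∷ plan) π =
    ∀ a → Any (λ (k , _) → ¬ T (consistent ((e , a) ∷ π) k)) ks ⊎ Refutes plan ((e , a) ∷ π)

  refutes? : ∀ plan π → Dec (Refutes plan π)
  refutes? []                π = no λ ()
  refutes? ((e , ks) ∷ plan) π = all? λ a →
    Any.any? (λ (k , _) → ¬? (T? (consistent ((e , a) ∷ π) k))) ks ⊎-dec refutes? plan ((e , a) ∷ π)

  refutes-sound : (s : StarEdgeColouring G q) → ∀ plan {π} →
    Agrees (StarEdgeColouring.colouring s) π → ¬ Refutes plan π
  refutes-sound s (((x , y) , ks) ∷ plan) agr r with r (col (StarEdgeColouring.colouring s) x y)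
  ... | inj₁ inconsistent =
    let (k , valid) , ¬consistent = Any.satisfied inconsistent
    in ¬consistent (consistent-sound _ (refl ∷ agr) valid (respects s valid))
  ... | inj₂ r′ = refutes-sound s plan (refl ∷ agr) r′

  orderedEdges : List (V G) → List (V G) → List (V G × V G)
  orderedEdges seen []       = []
  orderedEdges seen (u ∷ us) = map (_, u) (filter (λ v → adj? v u) seen) ++ orderedEdges (seen ++ u ∷ []) us

  position : List (V G × V G) → V G → V G → ℕ
  position []             u v = 0
  position ((x , y) ∷ es) u v = if does (sameEdge? (x , y) (u , v)) then 0 else suc (position es u v)

  latest : List (V G × V G) → Constraint → ℕ
  latest es (fan u v w)             = position es u v ⊔ position es u w
  latest es (trail v₀ v₁ v₂ v₃ v₄) = position es v₀ v₁ ⊔ position es v₁ v₂ ⊔ position es v₂ v₃ ⊔ position es v₃ v₄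

  -- Only one of a fan and its mirror image, and of a trail and its reversal, is kept.
  canonical : List (V G × V G) → Constraint → Bool
  canonical es (fan u v w)             = position es u v ℕ.<ᵇ position es u w
  canonical es (trail v₀ v₁ v₂ v₃ v₄) = position es v₀ v₁ ℕ.<ᵇ position es v₃ v₄

  schedule : ℕ → List (V G × V G) → List (ℕ × Certified) → Plan
  schedule i []       _   = []
  schedule i (e ∷ es) tks =
    (e , map proj₂ (filter (λ (t , _) → t ℕ.≤? i) tks)) ∷ schedule (suc i) es (filter (λ (t , _) → i ℕ.<? t) tks)

  -- The first k edges are left out of the plan: they are coloured in advance.
  plan : ℕ → List (V G) → Plan
  plan k order = planFor (orderedEdges [] order)
    where
    -- Taking the edge list as an argument makes the decision procedure compute it only once.
    planFor : List (V G × V G) → Plan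
    planFor es = schedule k (drop k es)
      (map (λ c → latest es (proj₁ c) , c) (filter (λ c → T? (canonical es (proj₁ c))) certified))

-- No star edge-colouring with five colours

relabel : Fin 5 → Fin 5 → Fin 5 → Fin 5 → Fin 5 → Fin 5
relabel x₀ x₁ x₂ x₃ y =
  if does (y ≟ᶠ x₀) then 0F else if does (y ≟ᶠ x₁) then 1F else
  if does (y ≟ᶠ x₂) then 2F else if does (y ≟ᶠ x₃) then 3F else 4F

relabel-normalises : ∀ x₀ x₁ x₂ x₃ → x₀ ≢ x₁ × x₀ ≢ x₂ × x₀ ≢ x₃ × x₁ ≢ x₂ × x₁ ≢ x₃ × x₂ ≢ x₃ →
  (∀ y z → relabel x₀ x₁ x₂ x₃ y ≡ relabel x₀ x₁ x₂ x₃ z → y ≡ z) ×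
  relabel x₀ x₁ x₂ x₃ x₀ ≡ 0F × relabel x₀ x₁ x₂ x₃ x₁ ≡ 1F × relabel x₀ x₁ x₂ x₃ x₂ ≡ 2F × relabel x₀ x₁ x₂ x₃ x₃ ≡ 3F
relabel-normalises = toWitness {a? = all? λ x₀ → all? λ x₁ → all? λ x₂ → all? λ x₃ →
  (¬? (x₀ ≟ᶠ x₁) ×-dec ¬? (x₀ ≟ᶠ x₂) ×-dec ¬? (x₀ ≟ᶠ x₃) ×-dec ¬? (x₁ ≟ᶠ x₂) ×-dec ¬? (x₁ ≟ᶠ x₃) ×-dec ¬? (x₂ ≟ᶠ x₃))
  →-dec
  ((all? λ y → all? λ z → (relabel x₀ x₁ x₂ x₃ y ≟ᶠ relabel x₀ x₁ x₂ x₃ z) →-dec (y ≟ᶠ z)) ×-dec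
   relabel x₀ x₁ x₂ x₃ x₀ ≟ᶠ 0F ×-dec relabel x₀ x₁ x₂ x₃ x₁ ≟ᶠ 1F ×-dec
   relabel x₀ x₁ x₂ x₃ x₂ ≟ᶠ 2F ×-dec relabel x₀ x₁ x₂ x₃ x₃ ≟ᶠ 3F)} _

module _ {G : Graph} (Gᵈ : DecidableGraph G) where
  open DecidableGraph Gᵈ
  open Refutation Gᵈ 5
  open import Data.List.Membership.DecPropositional _≟_ using (_∉?_)

  -- The first four edges of this vertex order are those from c to the nᵢ, coloured by centreColours.
  centredPlan : V G → V G → V G → V G → V G → Plan
  centredPlan c n₀ n₁ n₂ n₃ =
    plan 4 (c ∷ n₀ ∷ n₁ ∷ n₂ ∷ n₃ ∷ filter (_∉? (c ∷ n₀ ∷ n₁ ∷ n₂ ∷ n₃ ∷ [])) vertices)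

  centreColours : V G → V G → V G → V G → V G → Partial
  centreColours c n₀ n₁ n₂ n₃ = ((c , n₀) , 0F) ∷ ((c , n₁) , 1F) ∷ ((c , n₂) , 2F) ∷ ((c , n₃) , 3F) ∷ []

  refuteFiveColouring : ∀ c n₀ n₁ n₂ n₃ → Adj G c n₀ → Adj G c n₁ → Adj G c n₂ → Adj G c n₃ →
    n₀ ≢ n₁ → n₀ ≢ n₂ → n₀ ≢ n₃ → n₁ ≢ n₂ → n₁ ≢ n₃ → n₂ ≢ n₃ →
    {True (refutes? (centredPlan c n₀ n₁ n₂ n₃) (centreColours c n₀ n₁ n₂ n₃))} → ¬ StarEdgeColouring G 5
  refuteFiveColouring c n₀ n₁ n₂ n₃ a₀ a₁ a₂ a₃ d₀₁ d₀₂ d₀₃ d₁₂ d₁₃ d₂₃ {refutation} s =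
    let injective , e₀ , e₁ , e₂ , e₃ =
          relabel-normalises _ _ _ _ (ne a₀ a₁ d₀₁ , ne a₀ a₂ d₀₂ , ne a₀ a₃ d₀₃ , ne a₁ a₂ d₁₂ , ne a₁ a₃ d₁₃ , ne a₂ a₃ d₂₃)
    in refutes-sound (recolour _ (injective _ _) s) _ (e₀ ∷ e₁ ∷ e₂ ∷ e₃ ∷ []) (toWitness refutation)
    where
    open StarEdgeColouring s
    ne : ∀ {v w} → Adj G c v → Adj G c w → v ≢ w → col colouring c v ≢ col colouring c w
    ne {v} {w} = proper c v w

P₅□P₃-no5 : ¬ StarEdgeColouring (Path 5 □ Path 3) 5
P₅□P₃-no5 = refuteFiveColouring (pathᵈ 5 □ᵈ pathᵈ 3) (2F , 1F) (1F , 1F) (3F , 1F) (2F , 0F) (2F , 2F)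
  (inj₁ (inj₂ refl , refl)) (inj₁ (inj₁ refl , refl)) (inj₂ (refl , inj₂ refl)) (inj₂ (refl , inj₁ refl))
  (λ ()) (λ ()) (λ ()) (λ ()) (λ ()) (λ ())

C₄□P₃-no5 : ¬ StarEdgeColouring (Cycle 4 □ Path 3) 5
C₄□P₃-no5 = refuteFiveColouring (cycleᵈ 4 □ᵈ pathᵈ 3) (1F , 1F) (0F , 1F) (2F , 1F) (1F , 0F) (1F , 2F)
  (inj₁ (inj₂ (inj₁ refl) , refl)) (inj₁ (inj₁ (inj₁ refl) , refl)) (inj₂ (refl , inj₂ refl)) (inj₂ (refl , inj₁ refl))
  (λ ()) (λ ()) (λ ()) (λ ()) (λ ()) (λ ())

cylinder-no5 : 4 ≤ m → 3 ≤ n → ¬ StarEdgeColouring (Cycle m □ Path n) 5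
cylinder-no5 {suc (suc (suc (suc zero)))}    (s≤s (s≤s (s≤s (s≤s z≤n)))) 3≤n =
  C₄□P₃-no5 ∘ restrict (↪-refl □↪ path↪path 3≤n)
cylinder-no5 {suc (suc (suc (suc (suc m))))} (s≤s (s≤s (s≤s (s≤s z≤n)))) 3≤n =
  P₅□P₃-no5 ∘ restrict (path↪cycle (s≤s (s≤s (s≤s (s≤s (s≤s z≤n))))) □↪ path↪path 3≤n)

-- A star edge-colouring with six colours

data Move : Set where
  right left up down : Move

reverse : Move → Move
reverse right = left
reverse left  = right
reverse up    = down
reverse down  = up

moves : List Move
moves = right ∷ left ∷ up ∷ down ∷ []

∈-moves : ∀ m → m ∈ moves
∈-moves right = here refl
∈-moves left  = there (here refl)
∈-moves up    = there (there (here refl))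
∈-moves down  = there (there (there (here refl)))

_≟ₘ_ : DecidableEquality Move
m ≟ₘ m′ = map′ index-injective (cong index) (index m ≟ᶠ index m′)
  where
  index : Move → Fin 4
  index right = 0F
  index left  = 1F
  index up    = 2F
  index down  = 3F
  unindex : Fin 4 → Move
  unindex 0F = right
  unindex 1F = left
  unindex 2F = up
  unindex 3F = down
  unindex-index : ∀ m → unindex (index m) ≡ m
  unindex-index right = refl
  unindex-index left  = refl
  unindex-index up    = refl
  unindex-index down  = refl
  index-injective : ∀ {m m′} → index m ≡ index m′ → m ≡ m′
  index-injective {m} {m′} e = trans (sym (unindex-index m)) (trans (cong unindex e) (unindex-index m′))

ColumnType : Set
ColumnType = Fin 6

successors : ColumnType → List ColumnType
successors 0F = 1F ∷ []
successors 1F = 2F ∷ []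
successors 2F = 3F ∷ []
successors 3F = 0F ∷ 4F ∷ []
successors 4F = 5F ∷ []
successors 5F = 0F ∷ []

_⇒_ : ColumnType → ColumnType → Set
a ⇒ b = b ∈ successors a

predecessors : ColumnType → List ColumnType
predecessors b = filter (λ a → b ∈? successors a) (allFin 6)

Phase : Set
Phase = Fin 4

rotate : Phase → Phase
rotate 0F = 1F
rotate 1F = 2F
rotate 2F = 3F
rotate 3F = 0F

phase : ℕ → Phase
phase zero    = 0F
phase (suc j) = rotate (phase j)

State : Set
State = ColumnType × Phase

next : Move → State → List State
next right (a , r) = map (_, r) (successors a)
next left  (a , r) = map (_, r) (predecessors a)
next up    (a , r) = (a , rotate r) ∷ []
next down  (a , r) = map (a ,_) (filter (λ r′ → rotate r′ ≟ᶠ r) (allFin 4))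

byPhase : Fin 6 → Fin 6 → Fin 6 → Fin 6 → Phase → Fin 6
byPhase c₀ _ _ _ 0F = c₀
byPhase _ c₁ _ _ 1F = c₁
byPhase _ _ c₂ _ 2F = c₂
byPhase _ _ _ c₃ 3F = c₃

horizontal : ColumnType → ColumnType → Phase → Fin 6
horizontal 3F 4F = byPhase 4F 2F 5F 2F
horizontal 0F _  = byPhase 0F 3F 1F 3F
horizontal 1F _  = byPhase 1F 0F 0F 1F
horizontal 2F _  = byPhase 2F 1F 2F 0F
horizontal 3F _  = byPhase 3F 2F 3F 2F
horizontal 4F _  = byPhase 5F 5F 4F 4F
horizontal 5F _  = byPhase 3F 4F 3F 5F

vertical : ColumnType → Phase → Fin 6
vertical 0F = byPhase 1F 5F 0F 4F
vertical 1F = byPhase 2F 4F 2F 5F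
vertical 2F = byPhase 3F 5F 3F 4F
vertical 3F = byPhase 0F 4F 1F 5F
vertical 4F = byPhase 1F 3F 0F 3F
vertical 5F = byPhase 0F 2F 1F 2F

colour : Move → State → State → Fin 6
colour right (a , r) (b , _) = horizontal a b r
colour left  s       s′      = colour right s′ s
colour up    (a , r) _       = vertical a r
colour down  s       s′      = colour up s′ s

colour-reverse : ∀ m s s′ → colour (reverse m) s′ s ≡ colour m s s′
colour-reverse right _ _ = refl
colour-reverse left  _ _ = refl
colour-reverse up    _ _ = refl
colour-reverse down  _ _ = refl

Steps : State → (Move → State → Set) → Set
Steps s P = All (λ m → All (P m) (next m s)) moves

steps? : ∀ {P} s → (∀ m s′ → Dec (P m s′)) → Dec (Steps s P)
steps? s P? = All.all? (λ m → All.all? (P? m) _) _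

atStep : ∀ {P s s′} → Steps s P → ∀ m → s′ ∈ next m s → P m s′
atStep h m s′∈ = All.lookup (All.lookup h (∈-moves m)) s′∈

everyState? : {P : State → Set} → (∀ s → Dec (P s)) → Dec (∀ s → P s)
everyState? P? = map′ (λ h (a , r) → h a r) (λ h a r → h (a , r)) (all? λ a → all? λ r → P? (a , r))

-- Type 3 has two successors and type 0 two predecessors, so the labels do not form a graph that
-- the cylinder covers, and the checks below quantify over labelled steps only.
colour-proper : ∀ s → Steps s λ m₁ s₁ → Steps s λ m₂ s₂ → m₁ ≢ m₂ → colour m₁ s s₁ ≢ colour m₂ s s₂
colour-proper = toWitness {a? = everyState? λ s → steps? s λ m₁ s₁ → steps? s λ m₂ s₂ →
  ¬? (m₁ ≟ₘ m₂) →-dec ¬? (colour m₁ s s₁ ≟ᶠ colour m₂ s s₂)} _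

colour-nonAlternating : ∀ s₀ →
  Steps s₀ λ m₁ s₁ → Steps s₁ λ m₂ s₂ → Steps s₂ λ m₃ s₃ → Steps s₃ λ m₄ s₄ →
  m₂ ≢ reverse m₁ → m₃ ≢ reverse m₂ → m₄ ≢ reverse m₃ →
  ¬ (colour m₁ s₀ s₁ ≡ colour m₃ s₂ s₃ × colour m₂ s₁ s₂ ≡ colour m₄ s₃ s₄)
colour-nonAlternating = toWitness {a? = everyState? λ s₀ →
  steps? s₀ λ m₁ s₁ → steps? s₁ λ m₂ s₂ → steps? s₂ λ m₃ s₃ → steps? s₃ λ m₄ s₄ →
  ¬? (m₂ ≟ₘ reverse m₁) →-dec ¬? (m₃ ≟ₘ reverse m₂) →-dec ¬? (m₄ ≟ₘ reverse m₃) →-dec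
  ¬? (colour m₁ s₀ s₁ ≟ᶠ colour m₃ s₂ s₃ ×-dec colour m₂ s₁ s₂ ≟ᶠ colour m₄ s₃ s₄)} _

n≢2+n : ∀ n → n ≢ suc (suc n)
n≢2+n (suc n) e = n≢2+n n (suc-injective e)

3≤⇒≢2 : 3 ≤ n → n ≢ 2
3≤⇒≢2 (s≤s (s≤s ())) refl

3≤⇒≢1 : 3 ≤ n → n ≢ 1
3≤⇒≢1 (s≤s ()) refl

cycSucc-functional : ∀ {i j j′ : Fin n} → CycSucc n i j → CycSucc n i j′ → j ≡ j′
cycSucc-functional (inj₁ j≡)         (inj₁ j′≡)         = toℕ-injective (trans j≡ (sym j′≡))
cycSucc-functional (inj₁ j≡)         (inj₂ (last , _))  = ⊥-elim (<-irrefl (trans j≡ last) (toℕ<n _))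
cycSucc-functional (inj₂ (last , _)) (inj₁ j′≡)         = ⊥-elim (<-irrefl (trans j′≡ last) (toℕ<n _))
cycSucc-functional (inj₂ (_ , j≡0))  (inj₂ (_ , j′≡0))  = toℕ-injective (trans j≡0 (sym j′≡0))

cycSucc-injective : ∀ {i i′ j : Fin n} → CycSucc n i j → CycSucc n i′ j → i ≡ i′
cycSucc-injective (inj₁ j≡)         (inj₁ j≡′)          = toℕ-injective (suc-injective (trans (sym j≡) j≡′))
cycSucc-injective (inj₁ j≡)         (inj₂ (_ , j≡0))    = ⊥-elim (0≢1+n (trans (sym j≡0) j≡))
cycSucc-injective (inj₂ (_ , j≡0))  (inj₁ j≡)           = ⊥-elim (0≢1+n (trans (sym j≡0) j≡))
cycSucc-injective (inj₂ (last , _)) (inj₂ (last′ , _))  = toℕ-injective (suc-injective (trans last (sym last′)))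

cycSucc-asymmetric : 3 ≤ n → ∀ {i j : Fin n} → CycSucc n i j → ¬ CycSucc n j i
cycSucc-asymmetric _   (inj₁ j≡)           (inj₁ i≡)           = n≢2+n _ (trans i≡ (cong suc j≡))
cycSucc-asymmetric 3≤n (inj₁ j≡)           (inj₂ (last , i≡0)) =
  3≤⇒≢2 3≤n (trans (sym last) (cong suc (trans j≡ (cong suc i≡0))))
cycSucc-asymmetric 3≤n (inj₂ (last , j≡0)) (inj₁ i≡)           =
  3≤⇒≢2 3≤n (trans (sym last) (cong suc (trans i≡ (cong suc j≡0))))
cycSucc-asymmetric 3≤n (inj₂ (_ , j≡0))    (inj₂ (last , _))   = 3≤⇒≢1 3≤n (trans (sym last) (cong suc j≡0))

record ClosedWalk (N : ℕ) : Set where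
  field
    type  : ℕ → ColumnType
    step  : ∀ i → type i ⇒ type (suc i)
    close : ∀ i → suc i ≡ N → type i ⇒ type 0

module CylinderColouring {N : ℕ} (n : ℕ) (3≤N : 3 ≤ N) (walk : ClosedWalk N) where
  open ClosedWalk walk

  Cyl : Graph
  Cyl = Cycle N □ Path n

  column : Fin N → ColumnType
  column i = type (toℕ i)

  column-⇒ : ∀ {i i′} → CycSucc N i i′ → column i ⇒ column i′
  column-⇒ {i} (inj₁ i′≡)           = subst (λ x → column i ⇒ type x) (sym i′≡) (step _)
  column-⇒ {i} (inj₂ (last , i′≡0)) = subst (λ x → column i ⇒ type x) (sym i′≡0) (close _ last)

  state : V Cyl → State
  state (i , j) = column i , phase (toℕ j)

  Step : Move → V Cyl → V Cyl → Set
  Step right (i , j) (i′ , j′) = CycSucc N i i′ × j ≡ j′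
  Step left  (i , j) (i′ , j′) = CycSucc N i′ i × j ≡ j′
  Step up    (i , j) (i′ , j′) = i ≡ i′ × toℕ j′ ≡ suc (toℕ j)
  Step down  (i , j) (i′ , j′) = i ≡ i′ × toℕ j ≡ suc (toℕ j′)

  adj⇒step : ∀ {u v} → Adj Cyl u v → Σ Move λ m → Step m u v
  adj⇒step (inj₁ (inj₁ c , e)) = right , c , e
  adj⇒step (inj₁ (inj₂ c , e)) = left  , c , e
  adj⇒step (inj₂ (e , inj₁ s)) = up    , e , s
  adj⇒step (inj₂ (e , inj₂ s)) = down  , e , s

  step-reverse : ∀ m {u v} → Step m u v → Step (reverse m) v u
  step-reverse right (c , e) = c , sym e
  step-reverse left  (c , e) = c , sym e
  step-reverse up    (e , s) = sym e , s
  step-reverse down  (e , s) = sym e , s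

  step-functional : ∀ m {u v w} → Step m u v → Step m u w → v ≡ w
  step-functional right (c , refl) (c′ , refl) = cong (_, _) (cycSucc-functional c c′)
  step-functional left  (c , refl) (c′ , refl) = cong (_, _) (cycSucc-injective c c′)
  step-functional up    (refl , s) (refl , s′) = cong (_ ,_) (toℕ-injective (trans s (sym s′)))
  step-functional down  (refl , s) (refl , s′) = cong (_ ,_) (toℕ-injective (suc-injective (trans (sym s) s′)))

  no-return : ∀ m m′ {u v w} → Step m u v → Step m′ v w → u ≢ w → m′ ≢ reverse m
  no-return m _ s s′ u≢w refl = u≢w (step-functional (reverse m) (step-reverse m s) s′)

  step-state : ∀ m {u v} → Step m u v → state v ∈ next m (state u)
  step-state right {i , j} (c , refl) = ∈-map⁺ (_, phase (toℕ j)) (column-⇒ c)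
  step-state left  {i , j} (c , refl) =
    ∈-map⁺ (_, phase (toℕ j)) (∈-filter⁺ (λ a → column i ∈? successors a) (∈-allFin _) (column-⇒ c))
  step-state up    (refl , s) = here (cong (λ x → _ , phase x) s)
  step-state down  {i , j} (refl , s) =
    ∈-map⁺ (column i ,_) (∈-filter⁺ (λ r → rotate r ≟ᶠ phase (toℕ j)) (∈-allFin _) (cong phase (sym s)))

  direction : V Cyl → V Cyl → Move
  direction (i , j) (i′ , j′) =
    if does (j ≟ᶠ j′)
    then (if does (cycSucc? N i i′) then right else left)
    else (if does (toℕ j′ ℕ.≟ suc (toℕ j)) then up else down)

  direction-step : ∀ m {u v} → Step m u v → direction u v ≡ m
  direction-step right {i , j} {i′ , j′} (c , e)
    rewrite dec-true (j ≟ᶠ j′) e | dec-true (cycSucc? N i i′) c = refl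
  direction-step left  {i , j} {i′ , j′} (c , e)
    rewrite dec-true (j ≟ᶠ j′) e | dec-false (cycSucc? N i i′) (cycSucc-asymmetric 3≤N c) = refl
  direction-step up    {i , j} {i′ , j′} (_ , s)
    rewrite dec-false (j ≟ᶠ j′) (λ j≡j′ → 1+n≢n (trans (sym s) (cong toℕ (sym j≡j′))))
          | dec-true (toℕ j′ ℕ.≟ suc (toℕ j)) s = refl
  direction-step down  {i , j} {i′ , j′} (_ , s)
    rewrite dec-false (j ≟ᶠ j′) (λ j≡j′ → 1+n≢n (trans (sym s) (cong toℕ j≡j′)))
          | dec-false (toℕ j′ ℕ.≟ suc (toℕ j)) (λ s′ → n≢2+n _ (trans s′ (cong suc s))) = refl

  cylinderColour : V Cyl → V Cyl → Fin 6
  cylinderColour u v = colour (direction u v) (state u) (state v)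

  colour-step : ∀ m {u v} → Step m u v → cylinderColour u v ≡ colour m (state u) (state v)
  colour-step m s = cong (λ m′ → colour m′ _ _) (direction-step m s)

  colouring : EdgeColouring Cyl 6
  colouring = record { col = cylinderColour ; symm = symmetric }
    where
    symmetric : ∀ u v → Adj Cyl u v → cylinderColour u v ≡ cylinderColour v u
    symmetric u v uv with adj⇒step uv
    ... | m , s = trans (colour-step m s) (trans (sym (colour-reverse m _ _)) (sym (colour-step (reverse m) (step-reverse m s))))

  proper : Proper Cyl colouring
  proper u v w uv uw v≢w eq with adj⇒step uv | adj⇒step uw
  ... | m₁ , s₁ | m₂ , s₂ =
    atStep (atStep (colour-proper (state u)) m₁ (step-state m₁ s₁)) m₂ (step-state m₂ s₂)
      (λ { refl → v≢w (step-functional m₁ s₁ s₂) })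
      (trans (sym (colour-step m₁ s₁)) (trans eq (colour-step m₂ s₂)))

  noBichromatic : ¬ BichromaticP4orC4 Cyl colouring
  noBichromatic (v₀ , _ , _ , _ , _ , (a₀₁ , a₁₂ , a₂₃ , a₃₄) , (_ , d₀₂ , _ , _ , d₁₃ , _) , (_ , d₄₂ , _) , (e₁ , e₂))
    with adj⇒step a₀₁ | adj⇒step a₁₂ | adj⇒step a₂₃ | adj⇒step a₃₄
  ... | m₁ , s₁ | m₂ , s₂ | m₃ , s₃ | m₄ , s₄ =
    atStep (atStep (atStep (atStep (colour-nonAlternating (state v₀))
      m₁ (step-state m₁ s₁)) m₂ (step-state m₂ s₂)) m₃ (step-state m₃ s₃)) m₄ (step-state m₄ s₄)
      (no-return m₁ m₂ s₁ s₂ d₀₂) (no-return m₂ m₃ s₂ s₃ d₁₃) (no-return m₃ m₄ s₃ s₄ (d₄₂ ∘ sym))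
      ( trans (sym (colour-step m₁ s₁)) (trans e₁ (colour-step m₃ s₃))
      , trans (sym (colour-step m₂ s₂)) (trans e₂ (colour-step m₄ s₄)))

  star : StarEdgeColouring Cyl 6
  star = record { colouring = colouring ; proper = proper ; noBichrom = noBichromatic }

cyclic : ℕ → ColumnType
cyclic 0 = 0F
cyclic 1 = 1F
cyclic 2 = 2F
cyclic 3 = 3F
cyclic (suc (suc (suc (suc i)))) = cyclic i

cyclic-⇒ : ∀ i → cyclic i ⇒ cyclic (suc i)
cyclic-⇒ 0 = here refl
cyclic-⇒ 1 = here refl
cyclic-⇒ 2 = here refl
cyclic-⇒ 3 = here refl
cyclic-⇒ (suc (suc (suc (suc i)))) = cyclic-⇒ i

cyclic-last : ∀ a → cyclic (3 + a * 4) ≡ 3F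
cyclic-last zero    = refl
cyclic-last (suc a) = cyclic-last a

cyclicWalk : ∀ a → ClosedWalk (4 + a * 4)
cyclicWalk a = record
  { type  = cyclic
  ; step  = cyclic-⇒
  ; close = λ i last → subst (λ j → cyclic j ⇒ 0F) (sym (suc-injective last))
                         (subst (_⇒ 0F) (sym (cyclic-last a)) (here refl))
  }

detour : ℕ → ColumnType
detour 0 = 4F
detour 1 = 5F
detour (suc (suc i)) = cyclic i

detourWalk : ∀ a → ClosedWalk (6 + a * 4)
detourWalk a = record
  { type  = detour
  ; step  = λ { 0 → here refl ; 1 → here refl ; (suc (suc i)) → cyclic-⇒ i }
  ; close = λ i last → subst (λ j → detour j ⇒ 4F) (sym (suc-injective last))
                         (subst (_⇒ 4F) (sym (cyclic-last a)) (there (here refl)))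
  }

evenLength : ∀ k → (Σ ℕ λ a → 2 * (2 + k) ≡ 4 + a * 4) ⊎ (Σ ℕ λ a → 2 * (2 + k) ≡ 6 + a * 4)
evenLength 0 = inj₁ (0 , refl)
evenLength 1 = inj₂ (0 , refl)
evenLength (suc (suc k)) with evenLength k
... | inj₁ (a , e) = inj₁ (suc a , trans (*-distribˡ-+ 2 2 (2 + k)) (cong (4 +_) e))
... | inj₂ (a , e) = inj₂ (suc a , trans (*-distribˡ-+ 2 2 (2 + k)) (cong (4 +_) e))

evenClosedWalk : ∀ k → ClosedWalk (2 * (2 + k))
evenClosedWalk k with evenLength k
... | inj₁ (a , e) = subst ClosedWalk (sym e) (cyclicWalk a)
... | inj₂ (a , e) = subst ClosedWalk (sym e) (detourWalk a)

theorem21 : (k n : ℕ) → k ≥ 2 → n ≥ 3 →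
    StarChromaticIndex (Cycle (2 * k) □ Path n) 6
theorem21 (suc (suc k)) n (s≤s (s≤s _)) n≥3 =
    CylinderColouring.star n (<⇒≤ 4≤N) (evenClosedWalk k)
  , λ j j<6 s → cylinder-no5 4≤N n≥3 (recolour (λ c → inject≤ c (≤-pred j<6)) (inject≤-injective _ _ _ _) s)
  where
  4≤N : 4 ≤ 2 * (2 + k)
  4≤N = *-monoʳ-≤ 2 (m≤m+n 2 k)
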